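{- For every $n\ge1$, with $(1,\dots,1)$ the sequence of $n$ ones, the $n$-th Bell number satisfies $$B_n=L(1,\dots,1)=R(1,\dots,1)=\sum_{(p_2,\dots,p_n)\in\{0,1\}^{n-1}}\ \prod_{a=3}^{n}(1+p_2+\cdots+p_{a-1})^{1-p_a}.$$
   Context: $B_n$ is the number of set partitions of an $n$-element set. $\mathcal{A}_n=\{1<\cdots<n\}$. A composition diagram is a finite left-to-right sequence of nonempty bottom-justified columns of boxes; the bottom row consists of the lowest boxes. An lps tableau over $\mathcal{A}_n$: filling by elements of $\mathcal{A}_n$ with columns strictly increasing bottom to top and bottom row weakly increasing left to right. An rps tableau: columns weakly increasing bottom to top and bottom row strictly increasing left to right. $L(m_1,\dots,m_n)$ (resp. $R(m_1,\dots,m_n)$) is the number of lps (resp. rps) tableaux over $\mathcal{A}_n$ in which each symbol $a$ occurs exactly $m_a$ times. Empty products equal $1$. -}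

module Defs where

open import Data.Nat using (ℕ; zero; suc; _+_; _*_; _∸_; _^_; _<?_; _≤?_)
open import Data.Bool using (Bool; true; false)
open import Data.Fin using (Fin; toℕ) renaming (_<_ to _<ᶠ_; _≤_ to _≤ᶠ_; _≟_ to _≟ᶠ_)
open import Data.Vec using (Vec; []; _∷_; lookup)
open import Data.List using (List; []; _∷_; [_]; map; concat; concatMap; filter; length; allFin)
open import Data.Nat.ListAction using (sum; product)
open import Data.List.NonEmpty using (List⁺; head; toList)
open import Data.List.Relation.Unary.All using (All)
open import Data.List.Relation.Unary.Linked using (Linked)
open import Relation.Binary.PropositionalEquality using (_≡_)
open import Relation.Unary using (Pred)

-- Set partitions of the n-element set Fin n, represented by the
-- equivalence relation "lies in the same block" (an n×n Boolean matrix).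

record SetPartition (n : ℕ) : Set where
  field
    rel : Vec (Vec Bool n) n
  same : Fin n → Fin n → Bool
  same i j = lookup (lookup rel i) j
  field
    .reflexive  : ∀ i → same i i ≡ true
    .symmetric  : ∀ i j → same i j ≡ true → same j i ≡ true
    .transitive : ∀ i j k → same i j ≡ true → same j k ≡ true → same i k ≡ true

-- Fillings of composition diagrams over A_n = Fin n.
-- A filling is a left-to-right list of nonempty columns, each column
-- listed bottom to top.  The bottom row is the list of column heads.

Filling : ℕ → Set
Filling n = List (List⁺ (Fin n))

bottomRow : ∀ {n} → Filling n → List (Fin n)
bottomRow = map head

entries : ∀ {n} → Filling n → List (Fin n)
entries T = concat (map toList T)

occ : ∀ {n} → Filling n → Fin n → ℕ
occ T a = length (filter (_≟ᶠ a) (entries T))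

HasContent : ∀ {n} → (Fin n → ℕ) → Filling n → Set
HasContent m T = ∀ a → occ T a ≡ m a

record LpsTableau (n : ℕ) (m : Fin n → ℕ) : Set where
  field
    tab : Filling n
    .colsStrict  : All (λ c → Linked _<ᶠ_ (toList c)) tab
    .bottomWeak  : Linked _≤ᶠ_ (bottomRow tab)
    .content     : HasContent m tab

record RpsTableau (n : ℕ) (m : Fin n → ℕ) : Set where
  field
    tab : Filling n
    .colsWeak     : All (λ c → Linked _≤ᶠ_ (toList c)) tab
    .bottomStrict : Linked _<ᶠ_ (bottomRow tab)
    .content      : HasContent m tab

ones : ∀ {n} → Fin n → ℕ
ones _ = 1

-- The explicit sum, for n = suc k.  A vector p : Vec ℕ k with entries
-- in {0,1} encodes (p_2,…,p_n): position j (toℕ j = 0..k-1) is p_{j+2}.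

binVecs : (k : ℕ) → List (Vec ℕ k)
binVecs zero    = [ [] ]
binVecs (suc k) = concatMap (λ v → (0 ∷ v) ∷ (1 ∷ v) ∷ []) (binVecs k)

-- factor for a = toℕ j + 2 :  (1 + p_2 + … + p_{a-1}) ^ (1 - p_a)
factor : ∀ {k} → Vec ℕ k → Fin k → ℕ
factor {k} p j =
  (1 + sum (map (lookup p) (filter (λ i → toℕ i <? toℕ j) (allFin k))))
    ^ (1 ∸ lookup p j)

-- product over a = 3..n, i.e. toℕ j ≥ 1
weight : ∀ {k} → Vec ℕ k → ℕ
weight {k} p = product (map (factor p) (filter (λ j → 1 ≤? toℕ j) (allFin k)))

bellSum : ℕ → ℕ
bellSum k = sum (map weight (binVecs k))

module Submission where

-- Set partitions of Fin (n + 1), and lps/rps tableaux over A_{n+1} with content (1,…,1), all arise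
-- uniquely from objects of size n by adding the largest element n: into one of the c existing blocks
-- (on top of one of the c columns), or as a new singleton block (a new rightmost column).
-- Uniqueness holds because n is the largest symbol: it sits on top of its column, and a column
-- consisting of n alone must come last in the bottom row.  An old choice leaves c unchanged and a
-- new one raises it by one, so from an object with c choices there are growths c k ways to grow k
-- more steps, where growths c (k + 1) = c · growths c k + growths (c + 1) k.  The explicit sum obeys
-- the same recurrence: p_a = 1 records that a opened a new block or column, so 1 + p₂ + ⋯ + p_{a-1}
-- is the current c, and the factor (1 + p₂ + ⋯ + p_{a-1})^{1 - p_a} counts the old choices for a.

open import Defs
open import Data.Bool using (Bool; true; false)
open import Data.Bool.Properties using (¬-not; not-¬) renaming (_≟_ to _≟ᵇ_)
open import Data.Empty using (⊥; ⊥-elim; ⊥-elim-irr)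
open import Data.Fin using (Fin; toℕ; inject₁; fromℕ; _<_; _≤_; _≟_) renaming (zero to fzero; suc to fsuc)
import Data.Fin as Fin
open import Data.Fin.Properties
  using (toℕ-inject₁; toℕ-fromℕ; inject₁ℕ<; inject₁-injective; fromℕ≢inject₁; 0↔⊥; 1↔⊤; +↔⊎; *↔×)
open import Data.List
  using (List; []; _∷_; [_]; map; concat; concatMap; filter; length; allFin; tabulate; _++_; _∷ʳ_)
open import Data.List.NonEmpty using (List⁺; toList; _⁺∷ʳ_) renaming (_∷_ to _∷⁺_)
import Data.List.NonEmpty as List⁺
open import Data.List.Properties
  using ( map-tabulate; map-cong; map-∘; map-++; map-injective; length-++; length-map; filter-++; concat-++
        ; ∷-injective; ∷-injectiveˡ; ∷-injectiveʳ; ∷ʳ-injective)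
open import Data.List.Relation.Unary.All using (All; []; _∷_; all?)
import Data.List.Relation.Unary.All as All
open import Data.List.Relation.Unary.All.Properties using (++⁺; ++⁻ˡ; map⁺; map⁻)
open import Data.List.Relation.Unary.Linked using (Linked; []; [-]; _∷_; linked?)
import Data.List.Relation.Unary.Linked as Linked
import Data.List.Relation.Unary.Linked.Properties as Linked
open import Data.Maybe using (Maybe; just; nothing)
import Data.Maybe as Maybe
open import Data.Nat using (ℕ; zero; suc; _+_; _*_; _∸_; _^_; _<?_; _≤?_; s≤s; z≤n)
import Data.Nat as ℕ
open import Data.Nat.ListAction using (sum; product)
open import Data.Nat.Properties
  using ( +-identityʳ; +-assoc; +-comm; +-suc; *-identityˡ; *-identityʳ; *-zeroʳ; *-distribˡ-+; suc-injective
        ; m+n≡0⇒m≡0; m+n≡0⇒n≡0; <-irrefl; <-asym; <⇒≤; <⇒≱; +-commutativeSemigroup)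
open import Algebra.Properties.CommutativeSemigroup +-commutativeSemigroup using (interchange; xy∙z≈xz∙y)
open import Data.Product using (Σ; ∃; _×_; _,_; proj₁)
open import Data.Product.Function.Dependent.Propositional using (Σ-↔)
open import Data.Sum using (_⊎_; inj₁; inj₂)
open import Data.Sum.Function.Propositional using (_⊎-↔_)
open import Data.Unit using (⊤; tt)
open import Data.Vec using (Vec; []; _∷_; lookup)
import Data.Vec as Vec
open import Data.Vec.Properties using (lookup∘tabulate; tabulate∘lookup; tabulate-cong)
open import Function using (_∘_; id)
open import Function.Bundles using (_↔_; Inverse; mk↔ₛ′)
open import Function.Properties.Inverse using (↔-refl; ↔-sym; ↔-trans)
open import Function.Related.TypeIsomorphisms using (Σ-assoc; Σ-distribʳ-⊎; ⊎-comm)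
open import Relation.Nullary using (¬_; yes; no; does)
open import Relation.Nullary.Decidable using (recompute)
open import Relation.Binary.PropositionalEquality
  using (_≡_; _≢_; refl; sym; trans; cong; cong₂; subst; subst₂; module ≡-Reasoning)

infixr 5 _⟨↔⟩_
_⟨↔⟩_ : ∀ {A B C : Set} → A ↔ B → B ↔ C → A ↔ C
_⟨↔⟩_ = ↔-trans

≡⇒↔ : ∀ {A B : Set} → A ≡ B → A ↔ B
≡⇒↔ refl = ↔-refl

Σ-⊤ : ∀ {P : ⊤ → Set} → Σ ⊤ P ↔ P tt
Σ-⊤ = mk↔ₛ′ (λ { (tt , p) → p }) (tt ,_) (λ _ → refl) (λ _ → refl)

Σ-⊤ʳ : ∀ {A : Set} → Σ A (λ _ → ⊤) ↔ A
Σ-⊤ʳ = mk↔ₛ′ proj₁ (_, tt) (λ _ → refl) (λ _ → refl)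

⊎⊤↔Fin-suc : ∀ {A : Set} {c} → A ↔ Fin c → (A ⊎ ⊤) ↔ Fin (suc c)
⊎⊤↔Fin-suc {c = c} A↔c = ⊎-comm _ _ ⟨↔⟩ (↔-sym 1↔⊤ ⊎-↔ A↔c) ⟨↔⟩ ↔-sym (+↔⊎ {1} {c})

mk↔ₛ-injective : ∀ {A B : Set} (to : A → B) (from : B → A) →
  (∀ {b b′} → from b ≡ from b′ → b ≡ b′) → (∀ a → from (to a) ≡ a) → A ↔ B
mk↔ₛ-injective to from from-injective from∘to =
  mk↔ₛ′ to from (λ b → from-injective (from∘to (from b))) from∘to

growths : ℕ → ℕ → ℕ
growths c zero    = 1
growths c (suc k) = c * growths c k + growths (suc c) k

record Growth : Set₁ where
  field
    Obj       : ℕ → Set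
    Choice    : ∀ {n} → Obj n → Set
    extension : ∀ {n} → Σ (Obj n) (λ x → Choice x ⊎ ⊤) ↔ Obj (suc n)
    Obj₀↔⊤    : Obj 0 ↔ ⊤
    Choice₀↔⊥ : (x : Obj 0) → Choice x ↔ ⊥

  extend : ∀ {n} (x : Obj n) → Choice x ⊎ ⊤ → Obj (suc n)
  extend x c = Inverse.to extension (x , c)

  field
    Choice-old : ∀ {n} (x : Obj n) (c : Choice x) → Choice (extend x (inj₁ c)) ↔ Choice x
    Choice-new : ∀ {n} (x : Obj n) → Choice (extend x (inj₂ tt)) ↔ (Choice x ⊎ ⊤)

  Path : ∀ {n} → Obj n → ℕ → Set
  Path x zero    = ⊤
  Path x (suc k) = Σ (Choice x ⊎ ⊤) (λ c → Path (extend x c) k)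

  Σ-Path↔Obj : ∀ k {n} → Σ (Obj n) (λ x → Path x k) ↔ Obj (n + k)
  Σ-Path↔Obj zero    {n} = Σ-⊤ʳ ⟨↔⟩ ≡⇒↔ (cong Obj (sym (+-identityʳ n)))
  Σ-Path↔Obj (suc k) {n} =
    ↔-sym Σ-assoc ⟨↔⟩ Σ-↔ extension ↔-refl ⟨↔⟩ Σ-Path↔Obj k ⟨↔⟩ ≡⇒↔ (cong Obj (sym (+-suc n k)))

  Path↔Fin : ∀ k {n} (x : Obj n) {c} → Choice x ↔ Fin c → Path x k ↔ Fin (growths c k)
  Path↔Fin zero    x     x↔c = ↔-sym 1↔⊤
  Path↔Fin (suc k) x {c} x↔c =
    Σ-distribʳ-⊎
      ⟨↔⟩ (Σ-↔ x↔c (Path↔Fin k _ (Choice-old x _ ⟨↔⟩ x↔c))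
           ⊎-↔ (Σ-⊤ ⟨↔⟩ Path↔Fin k _ (Choice-new x ⟨↔⟩ ⊎⊤↔Fin-suc x↔c)))
      ⟨↔⟩ (↔-sym (*↔× {c}) ⊎-↔ ↔-refl)
      ⟨↔⟩ ↔-sym (+↔⊎ {c * growths c k})

  Obj↔Fin : ∀ k → Obj (suc k) ↔ Fin (growths 1 k)
  Obj↔Fin k =
    ↔-sym (Σ-Path↔Obj (suc k))
      ⟨↔⟩ Σ-↔ Obj₀↔⊤ (λ {x} → Path↔Fin (suc k) x (Choice₀↔⊥ x ⟨↔⟩ ↔-sym 0↔⊥))
      ⟨↔⟩ Σ-⊤

tabulate-fsuc : ∀ k → tabulate {n = k} fsuc ≡ map fsuc (allFin k)
tabulate-fsuc k = sym (map-tabulate id fsuc)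

prefixSum : ∀ {k} → Vec ℕ k → ℕ → ℕ
prefixSum []      m       = 0
prefixSum (x ∷ v) zero    = 0
prefixSum (x ∷ v) (suc m) = x + prefixSum v m

filter-<-fsuc : ∀ {k} (xs : List (Fin k)) m →
  filter (λ i → toℕ i <? suc m) (map fsuc xs) ≡ map fsuc (filter (λ i → toℕ i <? m) xs)
filter-<-fsuc []       m = refl
filter-<-fsuc (x ∷ xs) m with does (toℕ x <? m)
... | true  = cong (fsuc x ∷_) (filter-<-fsuc xs m)
... | false = filter-<-fsuc xs m

filter-<0 : ∀ {k} (xs : List (Fin k)) → filter (λ i → toℕ i <? 0) xs ≡ []
filter-<0 []       = refl
filter-<0 (x ∷ xs) = filter-<0 xs

sum-lookup-below : ∀ {k} (v : Vec ℕ k) m →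
  sum (map (lookup v) (filter (λ i → toℕ i <? m) (allFin k))) ≡ prefixSum v m
sum-lookup-below []               m       = refl
sum-lookup-below {suc k} (x ∷ v) zero    rewrite tabulate-fsuc k =
  cong (sum ∘ map (lookup (x ∷ v))) (filter-<0 (map fsuc (allFin k)))
sum-lookup-below {suc k} (x ∷ v) (suc m) rewrite tabulate-fsuc k | filter-<-fsuc (allFin k) m =
  cong (x +_) (trans (cong sum (sym (map-∘ (filter (λ i → toℕ i <? m) (allFin k))))) (sum-lookup-below v m))

filter-≥1-fsuc : ∀ {k} (xs : List (Fin k)) → filter (λ j → 1 ≤? toℕ j) (map fsuc xs) ≡ map fsuc xs
filter-≥1-fsuc []       = refl
filter-≥1-fsuc (x ∷ xs) = cong (fsuc x ∷_) (filter-≥1-fsuc xs)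

weightFrom : ∀ {k} → ℕ → Vec ℕ k → ℕ
weightFrom {k} c v = product (map (λ j → (c + prefixSum v (toℕ j)) ^ (1 ∸ lookup v j)) (allFin k))

weight-∷ : ∀ {k} x (v : Vec ℕ k) → weight (x ∷ v) ≡ weightFrom (suc x) v
weight-∷ {k} x v = begin
  weight (x ∷ v)
    ≡⟨ cong (λ l → product (map (factor (x ∷ v)) (filter (λ j → 1 ≤? toℕ j) (fzero ∷ l)))) (tabulate-fsuc k) ⟩
  product (map (factor (x ∷ v)) (filter (λ j → 1 ≤? toℕ j) (map fsuc (allFin k))))
    ≡⟨ cong (product ∘ map (factor (x ∷ v))) (filter-≥1-fsuc (allFin k)) ⟩
  product (map (factor (x ∷ v)) (map fsuc (allFin k)))
    ≡⟨ cong product (sym (map-∘ (allFin k))) ⟩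
  product (map (factor (x ∷ v) ∘ fsuc) (allFin k))
    ≡⟨ cong product (map-cong (λ j → cong (λ s → (1 + s) ^ (1 ∸ lookup v j))
                                          (sum-lookup-below (x ∷ v) (suc (toℕ j)))) (allFin k)) ⟩
  weightFrom (suc x) v ∎
  where open ≡-Reasoning

weightFrom-∷ : ∀ {k} c y (v : Vec ℕ k) → weightFrom c (y ∷ v) ≡ c ^ (1 ∸ y) * weightFrom (c + y) v
weightFrom-∷ {k} c y v rewrite tabulate-fsuc k | +-identityʳ c =
  cong (c ^ (1 ∸ y) *_) (trans (cong product (sym (map-∘ (allFin k))))
    (cong product (map-cong (λ j → cong (λ s → s ^ (1 ∸ lookup v j)) (sym (+-assoc c y (prefixSum v (toℕ j)))))
                            (allFin k))))

sum-map-+ : ∀ {A : Set} (f g : A → ℕ) xs → sum (map (λ v → f v + g v) xs) ≡ sum (map f xs) + sum (map g xs)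
sum-map-+ f g []       = refl
sum-map-+ f g (x ∷ xs) rewrite sum-map-+ f g xs = interchange (f x) (g x) (sum (map f xs)) (sum (map g xs))

sum-map-*ˡ : ∀ {A : Set} c (f : A → ℕ) xs → sum (map (λ v → c * f v) xs) ≡ c * sum (map f xs)
sum-map-*ˡ c f []       = sym (*-zeroʳ c)
sum-map-*ˡ c f (x ∷ xs) rewrite sum-map-*ˡ c f xs = sym (*-distribˡ-+ c (f x) _)

sum-map-binVecs-suc : ∀ {k} (f : Vec ℕ (suc k) → ℕ) (xs : List (Vec ℕ k)) →
  sum (map f (concatMap (λ v → (0 ∷ v) ∷ (1 ∷ v) ∷ []) xs)) ≡ sum (map (λ v → f (0 ∷ v) + f (1 ∷ v)) xs)
sum-map-binVecs-suc f []       = refl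
sum-map-binVecs-suc f (v ∷ xs) =
  trans (sym (+-assoc (f (0 ∷ v)) (f (1 ∷ v)) _)) (cong (f (0 ∷ v) + f (1 ∷ v) +_) (sum-map-binVecs-suc f xs))

weightSum : ℕ → ℕ → ℕ
weightSum c k = sum (map (weightFrom c) (binVecs k))

weightSum-suc : ∀ c k → weightSum c (suc k) ≡ c * weightSum c k + weightSum (suc c) k
weightSum-suc c k = begin
  weightSum c (suc k)
    ≡⟨ sum-map-binVecs-suc (weightFrom c) (binVecs k) ⟩
  sum (map (λ v → weightFrom c (0 ∷ v) + weightFrom c (1 ∷ v)) (binVecs k))
    ≡⟨ cong sum (map-cong (λ v → cong₂ _+_ (split₀ v) (split₁ v)) (binVecs k)) ⟩
  sum (map (λ v → c * weightFrom c v + weightFrom (suc c) v) (binVecs k))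
    ≡⟨ sum-map-+ (λ v → c * weightFrom c v) (weightFrom (suc c)) (binVecs k) ⟩
  sum (map (λ v → c * weightFrom c v) (binVecs k)) + weightSum (suc c) k
    ≡⟨ cong (_+ weightSum (suc c) k) (sum-map-*ˡ c (weightFrom c) (binVecs k)) ⟩
  c * weightSum c k + weightSum (suc c) k ∎
  where
  open ≡-Reasoning
  split₀ : ∀ v → weightFrom c (0 ∷ v) ≡ c * weightFrom c v
  split₀ v = trans (weightFrom-∷ c 0 v) (cong₂ _*_ (*-identityʳ c) (cong (λ z → weightFrom z v) (+-identityʳ c)))
  split₁ : ∀ v → weightFrom c (1 ∷ v) ≡ weightFrom (suc c) v
  split₁ v = trans (weightFrom-∷ c 1 v) (trans (+-identityʳ _) (cong (λ z → weightFrom z v) (+-comm c 1)))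

weightSum≡growths : ∀ c k → weightSum c k ≡ growths c k
weightSum≡growths c zero    = refl
weightSum≡growths c (suc k) =
  trans (weightSum-suc c k) (cong₂ (λ a b → c * a + b) (weightSum≡growths c k) (weightSum≡growths (suc c) k))

bellSum≡growths : ∀ k → bellSum k ≡ growths 1 k
bellSum≡growths zero    = refl
bellSum≡growths (suc k) = begin
  bellSum (suc k)
    ≡⟨ sum-map-binVecs-suc weight (binVecs k) ⟩
  sum (map (λ v → weight (0 ∷ v) + weight (1 ∷ v)) (binVecs k))
    ≡⟨ cong sum (map-cong (λ v → cong₂ _+_ (weight-∷ 0 v) (weight-∷ 1 v)) (binVecs k)) ⟩
  sum (map (λ v → weightFrom 1 v + weightFrom 2 v) (binVecs k))
    ≡⟨ sum-map-+ (weightFrom 1) (weightFrom 2) (binVecs k) ⟩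
  weightSum 1 k + weightSum 2 k
    ≡⟨ cong₂ _+_ (trans (weightSum≡growths 1 k) (sym (*-identityˡ _))) (weightSum≡growths 2 k) ⟩
  growths 1 (suc k) ∎
  where open ≡-Reasoning

inject₁⁻¹ : ∀ {n} → Fin (suc n) → Maybe (Fin n)
inject₁⁻¹ {zero}  fzero    = nothing
inject₁⁻¹ {suc n} fzero    = just fzero
inject₁⁻¹ {suc n} (fsuc i) = Maybe.map fsuc (inject₁⁻¹ i)

inject₁⁻¹-inject₁ : ∀ {n} (i : Fin n) → inject₁⁻¹ (inject₁ i) ≡ just i
inject₁⁻¹-inject₁ fzero                                = refl
inject₁⁻¹-inject₁ (fsuc i) rewrite inject₁⁻¹-inject₁ i = refl

inject₁⁻¹-fromℕ : ∀ n → inject₁⁻¹ (fromℕ n) ≡ nothing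
inject₁⁻¹-fromℕ zero                              = refl
inject₁⁻¹-fromℕ (suc n) rewrite inject₁⁻¹-fromℕ n = refl

data InjectOrLast {n} : Fin (suc n) → Set where
  injected : (i : Fin n) → InjectOrLast (inject₁ i)
  last     : InjectOrLast (fromℕ n)

injectOrLast : ∀ {n} (i : Fin (suc n)) → InjectOrLast i
injectOrLast {zero}  fzero    = last
injectOrLast {suc n} fzero    = injected fzero
injectOrLast {suc n} (fsuc i) with injectOrLast i
... | injected j = injected (fsuc j)
... | last       = last

inject₁-mono-< : ∀ {n} {i j : Fin n} → i < j → inject₁ i < inject₁ j
inject₁-mono-< {i = i} {j} = subst₂ (ℕ._<_) (sym (toℕ-inject₁ i)) (sym (toℕ-inject₁ j))

inject₁-cancel-< : ∀ {n} {i j : Fin n} → inject₁ i < inject₁ j → i < j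
inject₁-cancel-< {i = i} {j} = subst₂ (ℕ._<_) (toℕ-inject₁ i) (toℕ-inject₁ j)

inject₁-mono-≤ : ∀ {n} {i j : Fin n} → i ≤ j → inject₁ i ≤ inject₁ j
inject₁-mono-≤ {i = i} {j} = subst₂ (ℕ._≤_) (sym (toℕ-inject₁ i)) (sym (toℕ-inject₁ j))

inject₁-cancel-≤ : ∀ {n} {i j : Fin n} → inject₁ i ≤ inject₁ j → i ≤ j
inject₁-cancel-≤ {i = i} {j} = subst₂ (ℕ._≤_) (toℕ-inject₁ i) (toℕ-inject₁ j)

inject₁<fromℕ : ∀ {n} (i : Fin n) → inject₁ i < fromℕ n
inject₁<fromℕ {n} i = subst₂ (ℕ._<_) refl (sym (toℕ-fromℕ n)) (inject₁ℕ< i)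

fromℕ≰inject₁ : ∀ {n} (i : Fin n) → ¬ (fromℕ n ≤ inject₁ i)
fromℕ≰inject₁ i = <⇒≱ (inject₁<fromℕ i)

inject₁≢fromℕ : ∀ {n} {i : Fin n} → inject₁ i ≢ fromℕ n
inject₁≢fromℕ e = fromℕ≢inject₁ (sym e)

open SetPartition using (rel; same)

firstTrue : ∀ {n} → (Fin n → Bool) → Maybe (Fin n)
firstTrue {zero}  f = nothing
firstTrue {suc n} f with f fzero
... | true  = just fzero
... | false = Maybe.map fsuc (firstTrue (f ∘ fsuc))

IsFirstTrue : ∀ {n} → (Fin n → Bool) → Fin n → Set
IsFirstTrue f i = f i ≡ true × (∀ j → j < i → f j ≡ false)

firstTrue-nothing : ∀ {n} (f : Fin n → Bool) → firstTrue f ≡ nothing → ∀ i → f i ≡ false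
firstTrue-nothing {suc n} f e i with f fzero in f0
firstTrue-nothing {suc n} f () i        | true
firstTrue-nothing {suc n} f e fzero     | false = f0
firstTrue-nothing {suc n} f e (fsuc i)  | false with firstTrue (f ∘ fsuc) in e′
firstTrue-nothing {suc n} f () (fsuc i) | false | just _
firstTrue-nothing {suc n} f e (fsuc i)  | false | nothing = firstTrue-nothing (f ∘ fsuc) e′ i

firstTrue-just : ∀ {n} (f : Fin n → Bool) {i} → firstTrue f ≡ just i → IsFirstTrue f i
firstTrue-just {suc n} f e with f fzero in f0
firstTrue-just {suc n} f refl | true = f0 , λ _ ()
firstTrue-just {suc n} f e    | false with firstTrue (f ∘ fsuc) in e′
firstTrue-just {suc n} f ()   | false | nothing
firstTrue-just {suc n} f refl | false | just j with firstTrue-just (f ∘ fsuc) e′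
... | fi , below = fi , λ { fzero _ → f0 ; (fsuc j′) (s≤s j′<j) → below j′ j′<j }

firstTrue-allFalse : ∀ {n} (f : Fin n → Bool) → (∀ i → f i ≡ false) → firstTrue f ≡ nothing
firstTrue-allFalse {zero}  f none = refl
firstTrue-allFalse {suc n} f none with f fzero | none fzero
... | false | _ rewrite firstTrue-allFalse (f ∘ fsuc) (none ∘ fsuc) = refl

firstTrue-complete : ∀ {n} (f : Fin n → Bool) {i} → IsFirstTrue f i → firstTrue f ≡ just i
firstTrue-complete {suc n} f {fzero}  (fi , _) with f fzero | fi
... | true | _ = refl
firstTrue-complete {suc n} f {fsuc i} (fi , below) with f fzero | below fzero (s≤s z≤n)
... | false | _ rewrite firstTrue-complete (f ∘ fsuc) (fi , λ j j<i → below (fsuc j) (s≤s j<i)) = refl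

firstTrue-cong : ∀ {n} {f g : Fin n → Bool} → (∀ i → f i ≡ g i) → firstTrue f ≡ firstTrue g
firstTrue-cong {zero}          f≗g = refl
firstTrue-cong {suc n} {f} {g} f≗g with f fzero | g fzero | f≗g fzero
... | true  | .true  | refl = refl
... | false | .false | refl rewrite firstTrue-cong {f = f ∘ fsuc} {g ∘ fsuc} (f≗g ∘ fsuc) = refl

true⇔true⇒≡ : ∀ {a b : Bool} → (a ≡ true → b ≡ true) → (b ≡ true → a ≡ true) → a ≡ b
true⇔true⇒≡ {false} {false} _ _ = refl
true⇔true⇒≡ {false} {true}  _ g = g refl
true⇔true⇒≡ {true}  {false} f _ = sym (f refl)
true⇔true⇒≡ {true}  {true}  _ _ = refl

same-refl : ∀ {n} (x : SetPartition n) i → same x i i ≡ true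
same-refl record { reflexive = r } i = recompute (_ ≟ᵇ true) (r i)

same-sym : ∀ {n} (x : SetPartition n) {i j} → same x i j ≡ true → same x j i ≡ true
same-sym record { symmetric = s } p = recompute (_ ≟ᵇ true) (s _ _ p)

same-trans : ∀ {n} (x : SetPartition n) {i j k} → same x i j ≡ true → same x j k ≡ true → same x i k ≡ true
same-trans record { transitive = t } p q = recompute (_ ≟ᵇ true) (t _ _ _ p q)

relationMatrix : ∀ {n} → (Fin n → Fin n → Bool) → Vec (Vec Bool n) n
relationMatrix f = Vec.tabulate (Vec.tabulate ∘ f)

lookup-relationMatrix : ∀ {n} (f : Fin n → Fin n → Bool) i j → lookup (lookup (relationMatrix f) i) j ≡ f i j
lookup-relationMatrix f i j = trans (cong (λ v → lookup v j) (lookup∘tabulate _ i)) (lookup∘tabulate (f i) j)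

fromRelation : ∀ {n} (f : Fin n → Fin n → Bool) → .(∀ i → f i i ≡ true) →
  .(∀ i j → f i j ≡ true → f j i ≡ true) →
  .(∀ i j k → f i j ≡ true → f j k ≡ true → f i k ≡ true) → SetPartition n
fromRelation f r s t = record
  { rel        = relationMatrix f
  ; reflexive  = λ i → trans (same≡ i i) (r i)
  ; symmetric  = λ i j p → trans (same≡ j i) (s i j (trans (sym (same≡ i j)) p))
  ; transitive = λ i j k p q → trans (same≡ i k) (t i j k (trans (sym (same≡ i j)) p) (trans (sym (same≡ j k)) q))
  }
  where same≡ = lookup-relationMatrix f

same-injective : ∀ {n} {x y : SetPartition n} → (∀ i j → same x i j ≡ same y i j) → x ≡ y
same-injective {x = x} {y} x≗y = rel-injective (trans (tabulated x) (trans
  (tabulate-cong (λ i → tabulate-cong (x≗y i))) (sym (tabulated y))))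
  where
  tabulated : ∀ z → rel z ≡ Vec.tabulate (λ i → Vec.tabulate (same z i))
  tabulated z = trans (sym (tabulate∘lookup (rel z))) (tabulate-cong (λ i → sym (tabulate∘lookup (lookup (rel z) i))))
  rel-injective : ∀ {x y : SetPartition _} → rel x ≡ rel y → x ≡ y
  rel-injective {record { rel = r }} {record { rel = .r }} refl = refl

-- A block is named by its least element.
IsBlockMin : ∀ {n} → SetPartition n → Fin n → Set
IsBlockMin x j = ∀ i → i < j → same x i j ≡ false

record Block {n} (x : SetPartition n) : Set where
  constructor block
  field
    min     : Fin n
    .is-min : IsBlockMin x min
open Block

Block-≡ : ∀ {n} {x : SetPartition n} {a b : Block x} → min a ≡ min b → a ≡ b
Block-≡ {a = block a _} {block .a _} refl = refl

inBlock : ∀ {n} (x : SetPartition n) → Block x ⊎ ⊤ → Fin n → Bool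
inBlock x (inj₁ b) i = same x (min b) i
inBlock x (inj₂ _) i = false

-- nothing stands for the new element n.
sameAfter : ∀ {n} (x : SetPartition n) → Block x ⊎ ⊤ → Maybe (Fin n) → Maybe (Fin n) → Bool
sameAfter x c (just i) (just j) = same x i j
sameAfter x c (just i) nothing  = inBlock x c i
sameAfter x c nothing  (just j) = inBlock x c j
sameAfter x c nothing  nothing  = true

sameAfter-refl : ∀ {n} (x : SetPartition n) c u → sameAfter x c u u ≡ true
sameAfter-refl x c (just i) = same-refl x i
sameAfter-refl x c nothing  = refl

sameAfter-sym : ∀ {n} (x : SetPartition n) c u v → sameAfter x c u v ≡ true → sameAfter x c v u ≡ true
sameAfter-sym x c (just i) (just j) p = same-sym x p
sameAfter-sym x c (just i) nothing  p = p
sameAfter-sym x c nothing  (just j) p = p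
sameAfter-sym x c nothing  nothing  p = p

sameAfter-trans : ∀ {n} (x : SetPartition n) c u v w →
  sameAfter x c u v ≡ true → sameAfter x c v w ≡ true → sameAfter x c u w ≡ true
sameAfter-trans x c        (just i) (just j) (just k) p q = same-trans x p q
sameAfter-trans x (inj₁ b) (just i) (just j) nothing  p q = same-trans x q (same-sym x p)
sameAfter-trans x (inj₁ b) (just i) nothing  (just k) p q = same-trans x (same-sym x p) q
sameAfter-trans x (inj₁ b) nothing  (just j) (just k) p q = same-trans x p q
sameAfter-trans x c        (just i) nothing  nothing  p q = p
sameAfter-trans x c        nothing  (just j) nothing  p q = refl
sameAfter-trans x c        nothing  nothing  w        p q = q
sameAfter-trans x (inj₂ _) (just i) (just j) nothing  p ()
sameAfter-trans x (inj₂ _) (just i) nothing  (just k) () q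
sameAfter-trans x (inj₂ _) nothing  (just j) (just k) () q

extendPartition : ∀ {n} (x : SetPartition n) → Block x ⊎ ⊤ → SetPartition (suc n)
extendPartition x c = fromRelation (λ i j → sameAfter x c (inject₁⁻¹ i) (inject₁⁻¹ j))
  (λ i → sameAfter-refl x c (inject₁⁻¹ i))
  (λ i j → sameAfter-sym x c (inject₁⁻¹ i) (inject₁⁻¹ j))
  (λ i j k → sameAfter-trans x c (inject₁⁻¹ i) (inject₁⁻¹ j) (inject₁⁻¹ k))

restrictPartition : ∀ {n} → SetPartition (suc n) → SetPartition n
restrictPartition y = fromRelation (λ i j → same y (inject₁ i) (inject₁ j))
  (λ i → same-refl y _) (λ i j → same-sym y) (λ i j k → same-trans y)

same-extend : ∀ {n} (x : SetPartition n) c i j →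
  same (extendPartition x c) i j ≡ sameAfter x c (inject₁⁻¹ i) (inject₁⁻¹ j)
same-extend x c = lookup-relationMatrix (λ i j → sameAfter x c (inject₁⁻¹ i) (inject₁⁻¹ j))

same-restrict : ∀ {n} (y : SetPartition (suc n)) i j → same (restrictPartition y) i j ≡ same y (inject₁ i) (inject₁ j)
same-restrict y = lookup-relationMatrix (λ i j → same y (inject₁ i) (inject₁ j))

same-extend-inject₁ : ∀ {n} (x : SetPartition n) c i j →
  same (extendPartition x c) (inject₁ i) (inject₁ j) ≡ same x i j
same-extend-inject₁ x c i j
  rewrite same-extend x c (inject₁ i) (inject₁ j) | inject₁⁻¹-inject₁ i | inject₁⁻¹-inject₁ j = refl

same-extend-last : ∀ {n} (x : SetPartition n) c i →
  same (extendPartition x c) (inject₁ i) (fromℕ n) ≡ sameAfter x c (just i) nothing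
same-extend-last {n} x c i
  rewrite same-extend x c (inject₁ i) (fromℕ n) | inject₁⁻¹-inject₁ i | inject₁⁻¹-fromℕ n = refl

same-comm : ∀ {n} (x : SetPartition n) i j → same x i j ≡ same x j i
same-comm x i j = true⇔true⇒≡ (same-sym x) (same-sym x)

restrict-extend : ∀ {n} (x : SetPartition n) c → restrictPartition (extendPartition x c) ≡ x
restrict-extend x c = same-injective λ i j → trans (same-restrict (extendPartition x c) i j) (same-extend-inject₁ x c i j)

joinsLast : ∀ {n} → SetPartition (suc n) → Fin n → Bool
joinsLast {n} y i = same y (inject₁ i) (fromℕ n)

firstJoin-isBlockMin : ∀ {n} (y : SetPartition (suc n)) {i} → firstTrue (joinsLast y) ≡ just i →
  IsBlockMin (restrictPartition y) i
firstJoin-isBlockMin y e j j<i with firstTrue-just (joinsLast y) e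
... | i-joins , below = ¬-not λ j~i →
  not-¬ (same-trans y (trans (sym (same-restrict y j _)) j~i) i-joins) (below j j<i)

lastBlockOf : ∀ {n} (y : SetPartition (suc n)) m → firstTrue (joinsLast y) ≡ m → Block (restrictPartition y) ⊎ ⊤
lastBlockOf y (just i) e = inj₁ (block i (firstJoin-isBlockMin y e))
lastBlockOf y nothing  e = inj₂ tt

lastBlock : ∀ {n} (y : SetPartition (suc n)) → Block (restrictPartition y) ⊎ ⊤
lastBlock y = lastBlockOf y _ refl

inBlock-lastBlock : ∀ {n} (y : SetPartition (suc n)) i → inBlock (restrictPartition y) (lastBlock y) i ≡ joinsLast y i
inBlock-lastBlock y i = go _ refl
  where
  go : ∀ m (e : firstTrue (joinsLast y) ≡ m) → inBlock (restrictPartition y) (lastBlockOf y m e) i ≡ joinsLast y i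
  go (just k) e = trans (same-restrict y k i) (true⇔true⇒≡
    (λ k~i → same-trans y (same-sym y k~i) k-joins) (λ i-joins → same-trans y k-joins (same-sym y i-joins)))
    where k-joins = proj₁ (firstTrue-just (joinsLast y) e)
  go nothing  e = sym (firstTrue-nothing (joinsLast y) e i)

extend-restrict : ∀ {n} (y : SetPartition (suc n)) → extendPartition (restrictPartition y) (lastBlock y) ≡ y
extend-restrict {n} y = same-injective λ i j → go i j (injectOrLast i) (injectOrLast j)
  where
  x = restrictPartition y
  c = lastBlock y
  injected-last : ∀ a → same (extendPartition x c) (inject₁ a) (fromℕ n) ≡ same y (inject₁ a) (fromℕ n)
  injected-last a = trans (same-extend-last x c a) (inBlock-lastBlock y a)
  go : ∀ i j → InjectOrLast i → InjectOrLast j → same (extendPartition x c) i j ≡ same y i j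
  go _ _ (injected a) (injected b) = trans (same-extend-inject₁ x c a b) (same-restrict y a b)
  go _ _ (injected a) last         = injected-last a
  go _ _ last         (injected b) =
    trans (same-comm (extendPartition x c) (fromℕ n) (inject₁ b)) (trans (injected-last b) (same-comm y _ _))
  go _ _ last         last         = trans (same-extend x c (fromℕ n) (fromℕ n))
    (trans (cong₂ (sameAfter x c) (inject₁⁻¹-fromℕ n) (inject₁⁻¹-fromℕ n)) (sym (same-refl y (fromℕ n))))

representative : ∀ {n} {x : SetPartition n} → Block x ⊎ ⊤ → Maybe (Fin n)
representative (inj₁ b) = just (min b)
representative (inj₂ _) = nothing

representative-injective : ∀ {n} {x : SetPartition n} {c c′ : Block x ⊎ ⊤} →
  representative c ≡ representative c′ → c ≡ c′
representative-injective {c = inj₁ b} {inj₁ b′} refl = cong inj₁ (Block-≡ refl)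
representative-injective {c = inj₂ _} {inj₂ _}  _    = refl

representative-lastBlock : ∀ {n} (y : SetPartition (suc n)) → representative (lastBlock y) ≡ firstTrue (joinsLast y)
representative-lastBlock y = go _ refl
  where
  go : ∀ m (e : firstTrue (joinsLast y) ≡ m) → representative (lastBlockOf y m e) ≡ m
  go (just i) e = refl
  go nothing  e = refl

firstTrue-inBlock : ∀ {n} (x : SetPartition n) c → firstTrue (inBlock x c) ≡ representative c
firstTrue-inBlock x c@(inj₁ (block i i-min)) =
  firstTrue-complete (inBlock x c)
    (same-refl x i , λ j j<i → trans (same-comm x i j) (recompute (same x j i ≟ᵇ false) (i-min j j<i)))
firstTrue-inBlock x c@(inj₂ _) = firstTrue-allFalse (inBlock x c) (λ _ → refl)

lastBlock-extend : ∀ {n} (x : SetPartition n) c → representative (lastBlock (extendPartition x c)) ≡ representative c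
lastBlock-extend x c = trans (representative-lastBlock (extendPartition x c))
  (trans (firstTrue-cong (same-extend-last x c)) (firstTrue-inBlock x c))

partitionExtension : ∀ {n} → Σ (SetPartition n) (λ x → Block x ⊎ ⊤) ↔ SetPartition (suc n)
partitionExtension = mk↔ₛ′ (λ (x , c) → extendPartition x c) (λ y → restrictPartition y , lastBlock y)
  extend-restrict (λ (x , c) → Σ-≡ (restrict-extend x c) (lastBlock-extend x c))
  where
  Σ-≡ : ∀ {n} {x′ x : SetPartition n} {c′ : Block x′ ⊎ ⊤} {c : Block x ⊎ ⊤} → x′ ≡ x →
    representative c′ ≡ representative c → _≡_ {A = Σ (SetPartition n) (λ z → Block z ⊎ ⊤)} (x′ , c′) (x , c)
  Σ-≡ refl r = cong (_ ,_) (representative-injective r)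

module _ {n} (x : SetPartition n) where

  IsBlockMin-extend⁺ : ∀ {c a} → IsBlockMin x a → IsBlockMin (extendPartition x c) (inject₁ a)
  IsBlockMin-extend⁺ {c} {a} a-min i i<a = go i i<a (injectOrLast i)
    where
    go : ∀ i → i < inject₁ a → InjectOrLast i → same (extendPartition x c) i (inject₁ a) ≡ false
    go _ j<a (injected j) = trans (same-extend-inject₁ x c j a) (a-min j (inject₁-cancel-< j<a))
    go _ n<a last         = ⊥-elim (<-asym n<a (inject₁<fromℕ a))

  IsBlockMin-extend⁻ : ∀ {c a} → IsBlockMin (extendPartition x c) (inject₁ a) → IsBlockMin x a
  IsBlockMin-extend⁻ {c} {a} a-min i i<a =
    trans (sym (same-extend-inject₁ x c i a)) (a-min (inject₁ i) (inject₁-mono-< i<a))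

  last-isBlockMin : IsBlockMin (extendPartition x (inj₂ tt)) (fromℕ n)
  last-isBlockMin i i<n = go i i<n (injectOrLast i)
    where
    go : ∀ i → i < fromℕ n → InjectOrLast i → same (extendPartition x (inj₂ tt)) i (fromℕ n) ≡ false
    go _ _   (injected j) = same-extend-last x (inj₂ tt) j
    go _ n<n last         = ⊥-elim (<-irrefl refl n<n)

  last-not-isBlockMin : ∀ b → ¬ IsBlockMin (extendPartition x (inj₁ b)) (fromℕ n)
  last-not-isBlockMin b n-min =
    not-¬ (same-refl x (min b)) (trans (sym (same-extend-last x (inj₁ b) (min b))) (n-min _ (inject₁<fromℕ (min b))))

  oldBlocks : ∀ b → Block (extendPartition x (inj₁ b)) ↔ Block x
  oldBlocks b = mk↔ₛ-injective (λ (block j j-min) → lower j j-min (injectOrLast j)) raise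
    raise-injective (λ (block j j-min) → raise∘lower j j-min (injectOrLast j))
    where
    lower : ∀ j → .(IsBlockMin (extendPartition x (inj₁ b)) j) → InjectOrLast j → Block x
    lower _ a-min (injected a) = block a (IsBlockMin-extend⁻ a-min)
    lower _ n-min last         = ⊥-elim-irr (last-not-isBlockMin b n-min)
    raise : Block x → Block (extendPartition x (inj₁ b))
    raise (block a a-min) = block (inject₁ a) (IsBlockMin-extend⁺ a-min)
    raise-injective : ∀ {a a′} → raise a ≡ raise a′ → a ≡ a′
    raise-injective e = Block-≡ (inject₁-injective (cong min e))
    raise∘lower : ∀ j .j-min (v : InjectOrLast j) → raise (lower j j-min v) ≡ block j j-min
    raise∘lower _ _     (injected a) = Block-≡ refl
    raise∘lower _ n-min last         = ⊥-elim-irr (last-not-isBlockMin b n-min)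

  newBlocks : Block (extendPartition x (inj₂ tt)) ↔ (Block x ⊎ ⊤)
  newBlocks = mk↔ₛ-injective (λ (block j j-min) → lower j j-min (injectOrLast j)) raise
    raise-injective (λ (block j j-min) → raise∘lower j j-min (injectOrLast j))
    where
    lower : ∀ j → .(IsBlockMin (extendPartition x (inj₂ tt)) j) → InjectOrLast j → Block x ⊎ ⊤
    lower _ a-min (injected a) = inj₁ (block a (IsBlockMin-extend⁻ a-min))
    lower _ _     last         = inj₂ tt
    raise : Block x ⊎ ⊤ → Block (extendPartition x (inj₂ tt))
    raise (inj₁ (block a a-min)) = block (inject₁ a) (IsBlockMin-extend⁺ a-min)
    raise (inj₂ _)               = block (fromℕ n) last-isBlockMin
    raise-injective : ∀ {c c′} → raise c ≡ raise c′ → c ≡ c′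
    raise-injective {inj₁ _} {inj₁ _} e = cong inj₁ (Block-≡ (inject₁-injective (cong min e)))
    raise-injective {inj₁ _} {inj₂ _} e = ⊥-elim (fromℕ≢inject₁ (sym (cong min e)))
    raise-injective {inj₂ _} {inj₁ _} e = ⊥-elim (fromℕ≢inject₁ (cong min e))
    raise-injective {inj₂ _} {inj₂ _} e = refl
    raise∘lower : ∀ j .j-min (v : InjectOrLast j) → raise (lower j j-min v) ≡ block j j-min
    raise∘lower _ _ (injected a) = Block-≡ refl
    raise∘lower _ _ last         = Block-≡ refl

partitionGrowth : Growth
partitionGrowth = record
  { Obj        = SetPartition
  ; Choice     = Block
  ; extension  = partitionExtension
  ; Obj₀↔⊤     = mk↔ₛ′ (λ _ → tt) (λ _ → empty) (λ _ → refl) (λ _ → same-injective λ ())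
  ; Choice₀↔⊥  = λ _ → mk↔ₛ′ (λ { (block () _) }) (λ ()) (λ ()) (λ { (block () _) })
  ; Choice-old = oldBlocks
  ; Choice-new = newBlocks
  }
  where
  empty : SetPartition 0
  empty = fromRelation (λ ()) (λ ()) (λ ()) (λ ())

count : ∀ {n} → Fin n → List (Fin n) → ℕ
count a xs = length (filter (_≟ a) xs)

count-++ : ∀ {n} (a : Fin n) xs ys → count a (xs ++ ys) ≡ count a xs + count a ys
count-++ a xs ys = trans (cong length (filter-++ (_≟ a) xs ys)) (length-++ (filter (_≟ a) xs))

count-∷-≢ : ∀ {n} {a : Fin n} x xs → x ≢ a → count a (x ∷ xs) ≡ count a xs
count-∷-≢ {a = a} x xs x≢a with x ≟ a
... | yes x≡a = ⊥-elim (x≢a x≡a)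
... | no _    = refl

count-∷-≡ : ∀ {n} (a : Fin n) xs → count a (a ∷ xs) ≡ suc (count a xs)
count-∷-≡ a xs with a ≟ a
... | yes _  = refl
... | no a≢a = ⊥-elim (a≢a refl)

count-fromℕ-inject₁ : ∀ {n} (ys : List (Fin n)) → count (fromℕ n) (map inject₁ ys) ≡ 0
count-fromℕ-inject₁ []       = refl
count-fromℕ-inject₁ (y ∷ ys) =
  trans (count-∷-≢ (inject₁ y) (map inject₁ ys) inject₁≢fromℕ) (count-fromℕ-inject₁ ys)

count-inject₁ : ∀ {n} (b : Fin n) ys → count (inject₁ b) (map inject₁ ys) ≡ count b ys
count-inject₁ b []       = refl
count-inject₁ b (y ∷ ys) with y ≟ b
... | yes refl = trans (count-∷-≡ (inject₁ b) (map inject₁ ys)) (cong suc (count-inject₁ b ys))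
... | no y≢b   = trans (count-∷-≢ (inject₁ y) (map inject₁ ys) (y≢b ∘ inject₁-injective)) (count-inject₁ b ys)

count≡0⇒inject₁ : ∀ {n} (xs : List (Fin (suc n))) → count (fromℕ n) xs ≡ 0 → ∃ λ ys → xs ≡ map inject₁ ys
count≡0⇒inject₁ []       _ = [] , refl
count≡0⇒inject₁ (x ∷ xs) e with injectOrLast x
... | injected y with count≡0⇒inject₁ xs (trans (sym (count-∷-≢ (inject₁ y) xs inject₁≢fromℕ)) e)
...   | ys , refl = y ∷ ys , refl
count≡0⇒inject₁ (x ∷ xs) e | last with trans (sym (count-∷-≡ (fromℕ _) xs)) e
... | ()

Choices : ∀ {n} → Filling n → Set
Choices cs = Fin (length cs) ⊎ ⊤

liftColumn : ∀ {n} → List⁺ (Fin n) → List⁺ (Fin (suc n))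
liftColumn = List⁺.map inject₁

liftFilling : ∀ {n} → Filling n → Filling (suc n)
liftFilling = map liftColumn

insertLast : ∀ {n} (cs : Filling n) → Fin (length cs) → Filling (suc n)
insertLast {n} (c ∷ cs) fzero    = (liftColumn c ⁺∷ʳ fromℕ n) ∷ liftFilling cs
insertLast     (c ∷ cs) (fsuc i) = liftColumn c ∷ insertLast cs i

extendFilling : ∀ {n} (cs : Filling n) → Choices cs → Filling (suc n)
extendFilling     cs (inj₁ i) = insertLast cs i
extendFilling {n} cs (inj₂ _) = liftFilling cs ∷ʳ (fromℕ n ∷⁺ [])

shift : ∀ {m} → Fin m ⊎ ⊤ → Fin (suc m) ⊎ ⊤
shift (inj₁ i) = inj₁ (fsuc i)
shift (inj₂ t) = inj₂ t

data ChoiceView {m} : Fin (suc m) ⊎ ⊤ → Set where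
  first : ChoiceView (inj₁ fzero)
  later : (c : Fin m ⊎ ⊤) → ChoiceView (shift c)

choiceView : ∀ {m} (c : Fin (suc m) ⊎ ⊤) → ChoiceView c
choiceView (inj₁ fzero)    = first
choiceView (inj₁ (fsuc i)) = later (inj₁ i)
choiceView (inj₂ t)        = later (inj₂ t)

extendFilling-shift : ∀ {n} (d : List⁺ (Fin n)) ds (c : Choices ds) →
  extendFilling (d ∷ ds) (shift c) ≡ liftColumn d ∷ extendFilling ds c
extendFilling-shift d ds (inj₁ i) = refl
extendFilling-shift d ds (inj₂ t) = refl

length-insertLast : ∀ {n} (cs : Filling n) i → length (insertLast cs i) ≡ length cs
length-insertLast (c ∷ cs) fzero    = cong suc (length-map liftColumn cs)
length-insertLast (c ∷ cs) (fsuc i) = cong suc (length-insertLast cs i)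

length-newColumn : ∀ {n} (cs : Filling n) → length (extendFilling cs (inj₂ tt)) ≡ suc (length cs)
length-newColumn {n} cs = trans (length-++ (liftFilling cs) {[ fromℕ n ∷⁺ [] ]})
  (trans (cong (ℕ._+ 1) (length-map liftColumn cs)) (+-comm (length cs) 1))

filling₀ : (cs : Filling 0) → cs ≡ []
filling₀ []                = refl
filling₀ ((() ∷⁺ _) ∷ _)

entries-++ : ∀ {n} (cs ds : Filling n) → entries (cs ++ ds) ≡ entries cs ++ entries ds
entries-++ cs ds = trans (cong concat (map-++ toList cs ds)) (sym (concat-++ (map toList cs) (map toList ds)))

entries-liftFilling : ∀ {n} (cs : Filling n) → entries (liftFilling cs) ≡ map inject₁ (entries cs)
entries-liftFilling []       = refl
entries-liftFilling (c ∷ cs) =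
  trans (cong (map inject₁ (toList c) ++_) (entries-liftFilling cs)) (sym (map-++ inject₁ (toList c) (entries cs)))

count-insertLast : ∀ {n} (a : Fin (suc n)) (cs : Filling n) i →
  count a (entries (insertLast cs i)) ≡ count a (entries (liftFilling cs)) + count a [ fromℕ n ]
count-insertLast {n} a (c ∷ cs) fzero
  rewrite count-++ a (map inject₁ (toList c) ++ [ fromℕ n ]) (entries (liftFilling cs))
        | count-++ a (map inject₁ (toList c)) [ fromℕ n ]
        | count-++ a (map inject₁ (toList c)) (entries (liftFilling cs)) =
  xy∙z≈xz∙y (count a (map inject₁ (toList c))) (count a [ fromℕ n ]) (count a (entries (liftFilling cs)))
count-insertLast a (c ∷ cs) (fsuc i)
  rewrite count-++ a (map inject₁ (toList c)) (entries (insertLast cs i))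
        | count-++ a (map inject₁ (toList c)) (entries (liftFilling cs))
        | count-insertLast a cs i = sym (+-assoc (count a (map inject₁ (toList c))) _ _)

count-extendFilling : ∀ {n} (a : Fin (suc n)) (cs : Filling n) c →
  count a (entries (extendFilling cs c)) ≡ count a (map inject₁ (entries cs)) + count a [ fromℕ n ]
count-extendFilling a cs (inj₁ i) = trans (count-insertLast a cs i) (cong (λ xs → count a xs + _) (entries-liftFilling cs))
count-extendFilling {n} a cs (inj₂ _) = begin
  count a (entries (liftFilling cs ∷ʳ (fromℕ n ∷⁺ [])))
    ≡⟨ cong (count a) (entries-++ (liftFilling cs) [ fromℕ n ∷⁺ [] ]) ⟩
  count a (entries (liftFilling cs) ++ [ fromℕ n ])
    ≡⟨ count-++ a (entries (liftFilling cs)) [ fromℕ n ] ⟩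
  count a (entries (liftFilling cs)) + count a [ fromℕ n ]
    ≡⟨ cong (λ xs → count a xs + _) (entries-liftFilling cs) ⟩
  count a (map inject₁ (entries cs)) + count a [ fromℕ n ] ∎
  where open ≡-Reasoning

count-extendFilling-inject₁ : ∀ {n} (b : Fin n) (cs : Filling n) c →
  count (inject₁ b) (entries (extendFilling cs c)) ≡ count b (entries cs)
count-extendFilling-inject₁ {n} b cs c =
  trans (count-extendFilling (inject₁ b) cs c)
    (trans (cong₂ _+_ (count-inject₁ b (entries cs)) (count-∷-≢ (fromℕ n) [] fromℕ≢inject₁)) (+-identityʳ _))

count-extendFilling-fromℕ : ∀ {n} (cs : Filling n) c → count (fromℕ n) (entries (extendFilling cs c)) ≡ 1
count-extendFilling-fromℕ {n} cs c =
  trans (count-extendFilling (fromℕ n) cs c) (cong₂ _+_ (count-fromℕ-inject₁ (entries cs)) (count-∷-≡ (fromℕ n) []))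

content-extendFilling⁺ : ∀ {n} (cs : Filling n) c → HasContent ones cs → HasContent ones (extendFilling cs c)
content-extendFilling⁺ cs c once a with injectOrLast a
... | injected b = trans (count-extendFilling-inject₁ b cs c) (once b)
... | last       = count-extendFilling-fromℕ cs c

content-extendFilling⁻ : ∀ {n} (cs : Filling n) c → HasContent ones (extendFilling cs c) → HasContent ones cs
content-extendFilling⁻ cs c once b = trans (sym (count-extendFilling-inject₁ b cs c)) (once (inject₁ b))

bottomRow-liftFilling : ∀ {n} (cs : Filling n) → bottomRow (liftFilling cs) ≡ map inject₁ (bottomRow cs)
bottomRow-liftFilling []       = refl
bottomRow-liftFilling (c ∷ cs) = cong (inject₁ (List⁺.head c) ∷_) (bottomRow-liftFilling cs)

bottomRow-insertLast : ∀ {n} (cs : Filling n) i → bottomRow (insertLast cs i) ≡ map inject₁ (bottomRow cs)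
bottomRow-insertLast (c ∷ cs) fzero    = cong (inject₁ (List⁺.head c) ∷_) (bottomRow-liftFilling cs)
bottomRow-insertLast (c ∷ cs) (fsuc i) = cong (inject₁ (List⁺.head c) ∷_) (bottomRow-insertLast cs i)

bottomRow-newColumn : ∀ {n} (cs : Filling n) →
  bottomRow (extendFilling cs (inj₂ tt)) ≡ map inject₁ (bottomRow cs) ++ [ fromℕ n ]
bottomRow-newColumn {n} cs = trans (map-++ List⁺.head (liftFilling cs) [ fromℕ n ∷⁺ [] ])
  (cong (_++ [ fromℕ n ]) (bottomRow-liftFilling cs))

data Extension {n} : Filling (suc n) → Set where
  extension : (cs : Filling n) (c : Choices cs) → Extension (extendFilling cs c)

base : ∀ {n} {ds : Filling (suc n)} → Extension ds → Filling n
base (extension cs _) = cs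

choice : ∀ {n} {ds : Filling (suc n)} (e : Extension ds) → Choices (base e)
choice (extension _ c) = c

extendFilling-base : ∀ {n} {ds : Filling (suc n)} (e : Extension ds) → extendFilling (base e) (choice e) ≡ ds
extendFilling-base (extension _ _) = refl

extension-∷ : ∀ {n} (d : List⁺ (Fin n)) {cs} → Extension cs → Extension (liftColumn d ∷ cs)
extension-∷ d (extension cs c) = subst Extension (extendFilling-shift d cs c) (extension (d ∷ cs) (shift c))

lifted-column : ∀ {n} (c : List⁺ (Fin (suc n))) → count (fromℕ n) (toList c) ≡ 0 → ∃ λ d → c ≡ liftColumn d
lifted-column (x ∷⁺ xs) e with count≡0⇒inject₁ (x ∷ xs) e
... | y ∷ ys , refl = y ∷⁺ ys , refl

lifted-filling : ∀ {n} (cs : Filling (suc n)) → count (fromℕ n) (entries cs) ≡ 0 → ∃ λ ds → cs ≡ liftFilling ds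
lifted-filling []       _ = [] , refl
lifted-filling (c ∷ cs) e with trans (sym (count-++ _ (toList c) (entries cs))) e
... | e′ with lifted-column c (m+n≡0⇒m≡0 _ e′) | lifted-filling cs (m+n≡0⇒n≡0 _ e′)
... | d , refl | ds , refl = d ∷ ds , refl

sorted-count≡1 : ∀ {n} (xs : List (Fin (suc n))) → Linked _≤_ xs → count (fromℕ n) xs ≡ 1 →
  ∃ λ ys → xs ≡ map inject₁ ys ++ [ fromℕ n ]
sorted-count≡1 [] _ ()
sorted-count≡1 (x ∷ xs) sorted e with injectOrLast x
... | injected y
  with sorted-count≡1 xs (Linked.tail sorted) (trans (sym (count-∷-≢ (inject₁ y) xs inject₁≢fromℕ)) e)
...   | ys , refl = y ∷ ys , refl
sorted-count≡1 (x ∷ xs) sorted e | last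
  with count≡0⇒inject₁ xs (suc-injective (trans (sym (count-∷-≡ (fromℕ _) xs)) e))
... | []     , refl = [] , refl
... | y ∷ ys , refl = ⊥-elim (fromℕ≰inject₁ y (Linked.head sorted))

top-column : ∀ {n} (c : List⁺ (Fin (suc n))) → Linked _≤_ (toList c) → count (fromℕ n) (toList c) ≡ 1 →
  c ≡ fromℕ n ∷⁺ [] ⊎ ∃ λ d → c ≡ liftColumn d ⁺∷ʳ fromℕ n
top-column (x ∷⁺ xs) sorted e with sorted-count≡1 (x ∷ xs) sorted e
... | []     , refl = inj₁ refl
... | y ∷ ys , refl = inj₂ (y ∷⁺ ys , refl)

m+n≡1 : ∀ m {n} → m + n ≡ 1 → (m ≡ 0 × n ≡ 1) ⊎ (m ≡ 1 × n ≡ 0)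
m+n≡1 zero          e = inj₁ (refl , e)
m+n≡1 (suc zero)    e = inj₂ (refl , suc-injective e)
m+n≡1 (suc (suc m)) ()

shape : ∀ {n} (cs : Filling (suc n)) → All (λ c → Linked _≤_ (toList c)) cs → Linked _≤_ (bottomRow cs) →
  count (fromℕ n) (entries cs) ≡ 1 → Extension cs
shape [] _ _ ()
shape (c ∷ cs) (c↑ ∷ cs↑) bottom e with m+n≡1 _ (trans (sym (count-++ _ (toList c) (entries cs))) e)
... | inj₁ (c0 , cs1) with lifted-column c c0
...   | d , refl = extension-∷ d (shape cs cs↑ (Linked.tail bottom) cs1)
shape (c ∷ cs) (c↑ ∷ cs↑) bottom e | inj₂ (c1 , cs0) with top-column c c↑ c1 | lifted-filling cs cs0
... | inj₂ (d , refl) | ds , refl = extension (d ∷ ds) (inj₁ fzero)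
... | inj₁ refl       | [] , refl = extension [] (inj₂ tt)
... | inj₁ refl       | ((y ∷⁺ _) ∷ _) , refl = ⊥-elim (fromℕ≰inject₁ y (Linked.head bottom))

liftColumn-injective : ∀ {n} {c d : List⁺ (Fin n)} → liftColumn c ≡ liftColumn d → c ≡ d
liftColumn-injective {c = x ∷⁺ xs} {y ∷⁺ ys} e with ∷-injective (cong toList e)
... | x≡y , xs≡ys = cong₂ _∷⁺_ (inject₁-injective x≡y) (map-injective inject₁-injective xs≡ys)

pushColumn-injective : ∀ {n} {c d : List⁺ (Fin n)} →
  liftColumn c ⁺∷ʳ fromℕ n ≡ liftColumn d ⁺∷ʳ fromℕ n → c ≡ d
pushColumn-injective {c = x ∷⁺ xs} {y ∷⁺ ys} e with ∷-injective (cong toList e)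
... | x≡y , e′ = cong₂ _∷⁺_ (inject₁-injective x≡y)
  (map-injective inject₁-injective (proj₁ (∷ʳ-injective (map inject₁ xs) (map inject₁ ys) e′)))

inject₁-∷ʳ-fromℕ≢inject₁ : ∀ {n} (xs ys : List (Fin n)) → map inject₁ xs ++ [ fromℕ n ] ≢ map inject₁ ys
inject₁-∷ʳ-fromℕ≢inject₁ []       (y ∷ ys) e = inject₁≢fromℕ (sym (∷-injectiveˡ e))
inject₁-∷ʳ-fromℕ≢inject₁ (x ∷ xs) (y ∷ ys) e = inject₁-∷ʳ-fromℕ≢inject₁ xs ys (∷-injectiveʳ e)

pushColumn≢liftColumn : ∀ {n} (c d : List⁺ (Fin n)) → liftColumn c ⁺∷ʳ fromℕ n ≢ liftColumn d
pushColumn≢liftColumn c d e = inject₁-∷ʳ-fromℕ≢inject₁ (toList c) (toList d) (cong toList e)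

new≢∷ : ∀ {n} (d : List⁺ (Fin n)) ds (c : Choices (d ∷ ds)) →
  (fromℕ n ∷⁺ []) ∷ [] ≢ extendFilling (d ∷ ds) c
new≢∷ d ds c e with choiceView c
... | first    = inject₁≢fromℕ (sym (cong List⁺.head (∷-injectiveˡ e)))
... | later c₀ = inject₁≢fromℕ (sym (cong List⁺.head (∷-injectiveˡ (trans e (extendFilling-shift d ds c₀)))))

extendFilling-injective : ∀ {n} {cs cs′ : Filling n} (c : Choices cs) (c′ : Choices cs′) →
  extendFilling cs c ≡ extendFilling cs′ c′ → _≡_ {A = Σ (Filling n) Choices} (cs , c) (cs′ , c′)
extendFilling-injective {cs = []}    {[]}     (inj₂ _) (inj₂ _) e = refl
extendFilling-injective {cs = []}    {d ∷ ds} (inj₂ _) c′       e = ⊥-elim (new≢∷ d ds c′ e)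
extendFilling-injective {cs = d ∷ ds} {[]}    c        (inj₂ _) e = ⊥-elim (new≢∷ d ds c (sym e))
extendFilling-injective {cs = d ∷ ds} {d′ ∷ ds′} c c′ e with choiceView c | choiceView c′
... | first   | first    with ∷-injective e
...   | e₁ , e₂ with pushColumn-injective e₁ | map-injective liftColumn-injective e₂
...     | refl | refl = refl
extendFilling-injective {cs = d ∷ ds} {d′ ∷ ds′} c c′ e | first | later c₀′ =
  ⊥-elim (pushColumn≢liftColumn d d′ (∷-injectiveˡ (trans e (extendFilling-shift d′ ds′ c₀′))))
extendFilling-injective {cs = d ∷ ds} {d′ ∷ ds′} c c′ e | later c₀ | first =
  ⊥-elim (pushColumn≢liftColumn d′ d (∷-injectiveˡ (trans (sym e) (extendFilling-shift d ds c₀))))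
extendFilling-injective {cs = d ∷ ds} {d′ ∷ ds′} c c′ e | later c₀ | later c₀′
  with ∷-injective (trans (sym (extendFilling-shift d ds c₀)) (trans e (extendFilling-shift d′ ds′ c₀′)))
... | e₁ , e₂ with liftColumn-injective e₁ | extendFilling-injective {cs = ds} {ds′} c₀ c₀′ e₂
...   | refl | refl = refl

Linked-++⁻ˡ : ∀ {A : Set} {R : A → A → Set} (xs : List A) {ys} → Linked R (xs ++ ys) → Linked R xs
Linked-++⁻ˡ []           _       = []
Linked-++⁻ˡ (x ∷ [])     _       = [-]
Linked-++⁻ˡ (x ∷ y ∷ xs) (r ∷ l) = r ∷ Linked-++⁻ˡ (y ∷ xs) l

record Inject₁Stable (_∼_ : ∀ {m} → Fin m → Fin m → Set) : Set₁ where
  field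
    ∼⇒≤           : ∀ {m} {a b : Fin m} → a ∼ b → a ≤ b
    inject₁⁺      : ∀ {m} {a b : Fin m} → a ∼ b → inject₁ a ∼ inject₁ b
    inject₁⁻      : ∀ {m} {a b : Fin m} → inject₁ a ∼ inject₁ b → a ∼ b
    inject₁∼fromℕ : ∀ {m} (a : Fin m) → inject₁ a ∼ fromℕ m

  Linked-inject₁⁺ : ∀ {m} {xs : List (Fin m)} → Linked _∼_ xs → Linked _∼_ (map inject₁ xs)
  Linked-inject₁⁺ = Linked.map⁺ ∘ Linked.map inject₁⁺

  Linked-inject₁⁻ : ∀ {m} {xs : List (Fin m)} → Linked _∼_ (map inject₁ xs) → Linked _∼_ xs
  Linked-inject₁⁻ = Linked.map inject₁⁻ ∘ Linked.map⁻

  Linked-inject₁-∷ʳ-fromℕ : ∀ {m} {xs : List (Fin m)} →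
    Linked _∼_ xs → Linked _∼_ (map inject₁ xs ++ [ fromℕ m ])
  Linked-inject₁-∷ʳ-fromℕ {xs = []}        []      = [-]
  Linked-inject₁-∷ʳ-fromℕ {xs = x ∷ []}    [-]     = inject₁∼fromℕ x ∷ [-]
  Linked-inject₁-∷ʳ-fromℕ {xs = x ∷ y ∷ _} (r ∷ l) = inject₁⁺ r ∷ Linked-inject₁-∷ʳ-fromℕ l

  Linked-inject₁-∷ʳ-fromℕ⁻ : ∀ {m} (xs : List (Fin m)) →
    Linked _∼_ (map inject₁ xs ++ [ fromℕ m ]) → Linked _∼_ xs
  Linked-inject₁-∷ʳ-fromℕ⁻ xs = Linked-inject₁⁻ ∘ Linked-++⁻ˡ (map inject₁ xs)

  ColumnsSorted : ∀ {n} → Filling n → Set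
  ColumnsSorted = All (λ c → Linked _∼_ (toList c))

  columns-liftFilling⁺ : ∀ {n} {cs : Filling n} → ColumnsSorted cs → ColumnsSorted (liftFilling cs)
  columns-liftFilling⁺ = map⁺ ∘ All.map Linked-inject₁⁺

  columns-liftFilling⁻ : ∀ {n} {cs : Filling n} → ColumnsSorted (liftFilling cs) → ColumnsSorted cs
  columns-liftFilling⁻ = All.map Linked-inject₁⁻ ∘ map⁻

  columns-insertLast⁺ : ∀ {n} (cs : Filling n) i → ColumnsSorted cs → ColumnsSorted (insertLast cs i)
  columns-insertLast⁺ (c ∷ cs) fzero    (c↑ ∷ cs↑) = Linked-inject₁-∷ʳ-fromℕ c↑ ∷ columns-liftFilling⁺ cs↑
  columns-insertLast⁺ (c ∷ cs) (fsuc i) (c↑ ∷ cs↑) = Linked-inject₁⁺ c↑ ∷ columns-insertLast⁺ cs i cs↑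

  columns-insertLast⁻ : ∀ {n} (cs : Filling n) i → ColumnsSorted (insertLast cs i) → ColumnsSorted cs
  columns-insertLast⁻ (c ∷ cs) fzero    (c↑ ∷ cs↑) =
    Linked-inject₁-∷ʳ-fromℕ⁻ (toList c) c↑ ∷ columns-liftFilling⁻ cs↑
  columns-insertLast⁻ (c ∷ cs) (fsuc i) (c↑ ∷ cs↑) = Linked-inject₁⁻ c↑ ∷ columns-insertLast⁻ cs i cs↑

  columns-extendFilling⁺ : ∀ {n} (cs : Filling n) c → ColumnsSorted cs → ColumnsSorted (extendFilling cs c)
  columns-extendFilling⁺ cs (inj₁ i) = columns-insertLast⁺ cs i
  columns-extendFilling⁺ cs (inj₂ _) cs↑ = ++⁺ (columns-liftFilling⁺ cs↑) ([-] ∷ [])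

  columns-extendFilling⁻ : ∀ {n} (cs : Filling n) c → ColumnsSorted (extendFilling cs c) → ColumnsSorted cs
  columns-extendFilling⁻ cs (inj₁ i) = columns-insertLast⁻ cs i
  columns-extendFilling⁻ cs (inj₂ _) = columns-liftFilling⁻ ∘ ++⁻ˡ (liftFilling cs)

  bottom-extendFilling⁺ : ∀ {n} (cs : Filling n) c →
    Linked _∼_ (bottomRow cs) → Linked _∼_ (bottomRow (extendFilling cs c))
  bottom-extendFilling⁺ cs (inj₁ i) l = subst (Linked _∼_) (sym (bottomRow-insertLast cs i)) (Linked-inject₁⁺ l)
  bottom-extendFilling⁺ cs (inj₂ _) l = subst (Linked _∼_) (sym (bottomRow-newColumn cs)) (Linked-inject₁-∷ʳ-fromℕ l)

  bottom-extendFilling⁻ : ∀ {n} (cs : Filling n) c →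
    Linked _∼_ (bottomRow (extendFilling cs c)) → Linked _∼_ (bottomRow cs)
  bottom-extendFilling⁻ cs (inj₁ i) l = Linked-inject₁⁻ (subst (Linked _∼_) (bottomRow-insertLast cs i) l)
  bottom-extendFilling⁻ cs (inj₂ _) l =
    Linked-inject₁-∷ʳ-fromℕ⁻ (bottomRow cs) (subst (Linked _∼_) (bottomRow-newColumn cs) l)

module StandardTableaux {_∼ᶜ_ _∼ᵇ_ : ∀ {m} → Fin m → Fin m → Set}
  (columns : Inject₁Stable _∼ᶜ_) (bottom : Inject₁Stable _∼ᵇ_) where

  module C = Inject₁Stable columns
  module B = Inject₁Stable bottom

  record Tableau (n : ℕ) : Set where
    field
      tab     : Filling n
      .sorted : C.ColumnsSorted tab
      .row    : Linked _∼ᵇ_ (bottomRow tab)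
      .once   : HasContent ones tab
  open Tableau

  Tableau-≡ : ∀ {n} {x y : Tableau n} → tab x ≡ tab y → x ≡ y
  Tableau-≡ {x = record { tab = t }} {record { tab = .t }} refl = refl

  extendTableau : ∀ {n} (x : Tableau n) → Choices (tab x) → Tableau (suc n)
  extendTableau record { tab = cs ; sorted = s ; row = r ; once = o } c = record
    { tab    = extendFilling cs c
    ; sorted = C.columns-extendFilling⁺ cs c s
    ; row    = B.bottom-extendFilling⁺ cs c r
    ; once   = content-extendFilling⁺ cs c o
    }

  shapeOf : ∀ {n} (y : Tableau (suc n)) → Extension (tab y)
  shapeOf {n} record { tab = cs ; sorted = s ; row = r ; once = o } = shape cs
    (recompute (all? (λ c → linked? Fin._≤?_ (toList c)) cs) (All.map (Linked.map C.∼⇒≤) s))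
    (recompute (linked? Fin._≤?_ (bottomRow cs)) (Linked.map B.∼⇒≤ r))
    (recompute (_ ℕ.≟ 1) (o (fromℕ n)))

  restrictTableau : ∀ {n} → Tableau (suc n) → Σ (Tableau n) (Choices ∘ tab)
  restrictTableau y@record { sorted = s ; row = r ; once = o } = record
    { tab    = base e
    ; sorted = C.columns-extendFilling⁻ (base e) (choice e) (subst C.ColumnsSorted (sym (extendFilling-base e)) s)
    ; row    = B.bottom-extendFilling⁻ (base e) (choice e)
                 (subst (Linked _∼ᵇ_ ∘ bottomRow) (sym (extendFilling-base e)) r)
    ; once   = content-extendFilling⁻ (base e) (choice e) (subst (HasContent ones) (sym (extendFilling-base e)) o)
    } , choice e
    where e = shapeOf y

  Σ-Tableau-≡ : ∀ {n} {x y : Tableau n} {c d} →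
    _≡_ {A = Σ (Filling n) Choices} (tab x , c) (tab y , d) → _≡_ {A = Σ (Tableau n) (Choices ∘ tab)} (x , c) (y , d)
  Σ-Tableau-≡ {x = record { tab = t }} {record { tab = .t }} refl = refl

  tableauExtension : ∀ {n} → Σ (Tableau n) (Choices ∘ tab) ↔ Tableau (suc n)
  tableauExtension = mk↔ₛ′ (λ (x , c) → extendTableau x c) restrictTableau
    (λ y → Tableau-≡ (extendFilling-base (shapeOf y)))
    (λ (x , c) → Σ-Tableau-≡ (extendFilling-injective _ c (extendFilling-base (shapeOf (extendTableau x c)))))

  tableauGrowth : Growth
  tableauGrowth = record
    { Obj        = Tableau
    ; Choice     = λ x → Fin (length (tab x))
    ; extension  = tableauExtension
    ; Obj₀↔⊤     = mk↔ₛ′ (λ _ → tt) (λ _ → empty) (λ _ → refl) (λ x → Tableau-≡ (sym (filling₀ (tab x))))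
    ; Choice₀↔⊥  = λ x → ≡⇒↔ (cong (Fin ∘ length) (filling₀ (tab x))) ⟨↔⟩ 0↔⊥
    ; Choice-old = λ x i → ≡⇒↔ (cong Fin (length-insertLast (tab x) i))
    ; Choice-new = λ x → ≡⇒↔ (cong Fin (length-newColumn (tab x))) ⟨↔⟩ ↔-sym (⊎⊤↔Fin-suc ↔-refl)
    }
    where
    empty : Tableau 0
    empty = record { tab = [] ; sorted = [] ; row = [] ; once = λ () }

<-stable : Inject₁Stable _<_
<-stable = record
  { ∼⇒≤ = <⇒≤ ; inject₁⁺ = inject₁-mono-< ; inject₁⁻ = inject₁-cancel-< ; inject₁∼fromℕ = inject₁<fromℕ }

≤-stable : Inject₁Stable _≤_
≤-stable = record
  { ∼⇒≤ = id ; inject₁⁺ = inject₁-mono-≤ ; inject₁⁻ = inject₁-cancel-≤ ; inject₁∼fromℕ = <⇒≤ ∘ inject₁<fromℕ }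

module Lps = StandardTableaux <-stable ≤-stable
module Rps = StandardTableaux ≤-stable <-stable

lps↔tableau : ∀ {n} → LpsTableau n ones ↔ Lps.Tableau n
lps↔tableau = mk↔ₛ′
  (λ { record { tab = t ; colsStrict = s ; bottomWeak = r ; content = o } →
          record { tab = t ; sorted = s ; row = r ; once = o } })
  (λ { record { tab = t ; sorted = s ; row = r ; once = o } →
          record { tab = t ; colsStrict = s ; bottomWeak = r ; content = o } })
  (λ _ → refl) (λ _ → refl)

rps↔tableau : ∀ {n} → RpsTableau n ones ↔ Rps.Tableau n
rps↔tableau = mk↔ₛ′
  (λ { record { tab = t ; colsWeak = s ; bottomStrict = r ; content = o } →
          record { tab = t ; sorted = s ; row = r ; once = o } })
  (λ { record { tab = t ; sorted = s ; row = r ; once = o } →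
          record { tab = t ; colsWeak = s ; bottomStrict = r ; content = o } })
  (λ _ → refl) (λ _ → refl)

corollary4p7 : (k : ℕ) →
    (SetPartition (suc k) ↔ Fin (bellSum k))
    × (LpsTableau (suc k) ones ↔ Fin (bellSum k))
    × (RpsTableau (suc k) ones ↔ Fin (bellSum k))
corollary4p7 k =
    Growth.Obj↔Fin partitionGrowth k ⟨↔⟩ growths≡bellSum
  , lps↔tableau ⟨↔⟩ Growth.Obj↔Fin Lps.tableauGrowth k ⟨↔⟩ growths≡bellSum
  , rps↔tableau ⟨↔⟩ Growth.Obj↔Fin Rps.tableauGrowth k ⟨↔⟩ growths≡bellSum
  where
  growths≡bellSum : Fin (growths 1 k) ↔ Fin (bellSum k)
  growths≡bellSum = ≡⇒↔ (cong Fin (sym (bellSum≡growths k)))
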